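{- A proximity poset $(S,\le,\prec)$ admits a $\mathrm{P_U}$-coalgebra structure (i.e. there is a coalgebra $\alpha:S\to\mathrm{P_U}(S)$ of the upper powerlocale comonad on $\mathsf{PxPos}$) if and only if the poset $\mathrm{RIdl}(S)$ of rounded ideals of $S$, ordered by inclusion, has finite meets.
   Context: Work constructively; $\mathrm{Fin}(S)$ is the set of finitely enumerable subsets. A proximity poset is $(S,\le,\prec)$ with $(S,\le)$ a poset and $\prec$ a relation such that for every $a$: $\{b\mid b\prec a\}$ is a rounded ideal (a downward closed, inhabited, upward directed $I$ with $x\in I\iff\exists y\,(x\prec y\ \&\ y\in I)$) and $\{b\mid a\prec b\}$ is a rounded upward closed set ($x\in U\iff\exists y\,(y\prec x\ \&\ y\in U)$). Approximable relations $(S,\prec)\to(S',\prec')$: $r\subseteq S\times S'$ with $\{a\mid a\,r\,b\}$ a rounded ideal for each $b$ and $\{b\mid a\,r\,b\}$ a rounded upward closed set for each $a$. $\mathsf{PxPos}$: proximity posets and approximable relations, identity $\prec$, relational composition. For $r\subseteq X\times Y$, $A\,r_U\,B\iff\forall b\in B\,\exists a\in A\,(a\,r\,b)$. The upper powerlocale comonad $\mathrm{P_U}$ on $\mathsf{PxPos}$: $\mathrm{P_U}(S)=((\mathrm{Fin}(S),\le_U),\prec_U)$ (poset reflection of the preorder $\le_U$), $\mathrm{P_U}(r)=r_U$, counit $A\,\varepsilon^U_S\,a\iff A\prec_U\{a\}$, comultiplication $A\,\nu^U_S\,\mathcal U\iff A\prec_U\bigcup\mathcal U$. A coalgebra is $\alpha:S\to\mathrm{P_U}(S)$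 with $\varepsilon^U_S\circ\alpha=\prec$ and $\nu^U_S\circ\alpha=\mathrm{P_U}(\alpha)\circ\alpha$. -}

module Defs where

open import Level using (Level; 0ℓ) renaming (suc to lsuc)
open import Data.Product using (Σ; ∃; _×_; _,_)
open import Data.List using (List; [_]; concat)
open import Data.List.Membership.Propositional using (_∈_)
open import Relation.Binary.Core using (Rel; REL)
open import Relation.Binary.Structures using (IsPartialOrder)
open import Relation.Binary.PropositionalEquality using (_≡_)
open import Function.Bundles using (_⇔_)

record IsRoundedIdeal {X : Set} (_≤_ _≺_ : Rel X 0ℓ) (I : X → Set) : Set where
  field
    downClosed : ∀ {x y} → x ≤ y → I y → I x
    inhabited  : ∃ λ x → I x
    directed   : ∀ {x y} → I x → I y → ∃ λ z → I z × x ≤ z × y ≤ z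
    rounded    : ∀ x → I x ⇔ (∃ λ y → x ≺ y × I y)

record IsRoundedUpper {X : Set} (_≤_ _≺_ : Rel X 0ℓ) (U : X → Set) : Set where
  field
    upClosed : ∀ {x y} → x ≤ y → U x → U y
    rounded  : ∀ x → U x ⇔ (∃ λ y → y ≺ x × U y)

record ProximityPoset : Set₁ where
  field
    Carrier        : Set
    _≤_            : Rel Carrier 0ℓ
    _≺_            : Rel Carrier 0ℓ
    isPartialOrder : IsPartialOrder _≡_ _≤_
    lowerRIdeal    : ∀ a → IsRoundedIdeal _≤_ _≺_ (λ b → b ≺ a)
    upperRUpper    : ∀ a → IsRoundedUpper _≤_ _≺_ (λ b → a ≺ b)

-- Finitely enumerable subsets as lists; the lifting r ↦ r_U.

Fin : Set → Set
Fin = List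

_[_]U_ : {X Y : Set} → Fin X → REL X Y 0ℓ → Fin Y → Set
A [ r ]U B = ∀ {b} → b ∈ B → ∃ λ a → a ∈ A × r a b

_∘ʳ_ : {X Y Z : Set} → REL Y Z 0ℓ → REL X Y 0ℓ → REL X Z 0ℓ
(s ∘ʳ r) a c = ∃ λ b → r a b × s b c

_≐_ : {X Y : Set} → REL X Y 0ℓ → REL X Y 0ℓ → Set
r ≐ s = ∀ a b → r a b ⇔ s a b

record IsApproximable {X Y : Set} (_≤_ _≺_ : Rel X 0ℓ) (_≤'_ _≺'_ : Rel Y 0ℓ)
                      (r : REL X Y 0ℓ) : Set where
  field
    ideal : ∀ b → IsRoundedIdeal _≤_ _≺_ (λ a → r a b)
    upper : ∀ a → IsRoundedUpper _≤'_ _≺'_ (λ b → r a b)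

module _ (S : ProximityPoset) where
  open ProximityPoset S

  -- P_U(S): carrier Fin(S) with the preorder ≤_U (we work with the
  -- preorder; approximable relations are invariant under its
  -- equivalence) and ≺_U.
  _≤U_ : Rel (Fin Carrier) 0ℓ
  A ≤U B = A [ _≤_ ]U B

  _≺U_ : Rel (Fin Carrier) 0ℓ
  A ≺U B = A [ _≺_ ]U B

  εU : REL (Fin Carrier) Carrier 0ℓ
  εU A a = A ≺U [ a ]

  νU : REL (Fin Carrier) (Fin (Fin Carrier)) 0ℓ
  νU A 𝒰 = A ≺U concat 𝒰

  PU : REL Carrier (Fin Carrier) 0ℓ → REL (Fin Carrier) (Fin (Fin Carrier)) 0ℓ
  PU r A 𝒰 = A [ r ]U 𝒰

  record IsPUCoalgebra (α : REL Carrier (Fin Carrier) 0ℓ) : Set where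
    field
      approximable : IsApproximable _≤_ _≺_ _≤U_ _≺U_ α
      counitLaw    : (εU ∘ʳ α) ≐ _≺_
      coassocLaw   : (νU ∘ʳ α) ≐ (PU α ∘ʳ α)

  record RIdl : Set₁ where
    field
      pred    : Carrier → Set
      isRIdl  : IsRoundedIdeal _≤_ _≺_ pred
  open RIdl public

  _⊆I_ : RIdl → RIdl → Set
  I ⊆I J = ∀ {a} → pred I a → pred J a

  record HasFiniteMeets : Set₁ where
    field
      top     : RIdl
      top-max : ∀ I → I ⊆I top
      meet    : RIdl → RIdl → RIdl
      meet-lb₁ : ∀ I J → meet I J ⊆I I
      meet-lb₂ : ∀ I J → meet I J ⊆I J
      meet-glb : ∀ I J K → K ⊆I I → K ⊆I J → K ⊆I meet I J

  HasPUCoalgebra : Set₁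
  HasPUCoalgebra = Σ (REL Carrier (Fin Carrier) 0ℓ) IsPUCoalgebra

{-# OPTIONS --safe #-}
-- The counit law together with roundedness of α a gives α a [ b ] ⇔ a ≺ b, so
-- α a A behaves like "a lies in the meet of the principal ideals ↓b, b ∈ A".
-- Hence a coalgebra yields the top ideal {a | α a []} and binary meets
-- I ∧ J = {a | ∃ x ∈ I, y ∈ J. α a [x, y]};
-- conversely, finite meets define α a A := a ∈ ⋀_{b ∈ A} ↓b, whose counit and
-- comultiplication laws reduce to roundedness of these meets.
module Submission where

open import Defs
open import Level using (0ℓ)
open import Function.Base using (_∘_)
open import Function.Bundles using (_⇔_; mk⇔; Equivalence)
open import Function.Construct.Composition using (_⇔-∘_)
open import Function.Construct.Symmetry using (⇔-sym)
open import Data.Product using (∃; ∃₂; _×_; _,_; map₂; swap)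
open import Data.List using ([]; _∷_; [_]; concat)
open import Data.List.Relation.Unary.Any using (here; there)
open import Data.List.Membership.Propositional using (_∈_)
open import Data.List.Membership.Propositional.Properties using (∈-concat⁺′; ∈-concat⁻′)
open import Data.List.Relation.Binary.Subset.Propositional using (_⊆_)
open import Relation.Binary.Core using (Rel; REL)
open import Relation.Binary.Structures using (IsPartialOrder)
open import Relation.Binary.PropositionalEquality using (refl)

open Equivalence

∃-×-comm : {X : Set} {P Q : X → Set} → (∃ λ x → P x × Q x) ⇔ (∃ λ x → Q x × P x)
∃-×-comm = mk⇔ (map₂ swap) (map₂ swap)

module RoundedIdeal {X : Set} {_≤_ _≺_ : Rel X 0ℓ} {I : X → Set}
                    (isI : IsRoundedIdeal _≤_ _≺_ I) where
  open IsRoundedIdeal isI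

  ≺-closed : ∀ {x y} → x ≺ y → I y → I x
  ≺-closed {x} x≺y Iy = from (rounded x) (_ , x≺y , Iy)

  expand : ∀ {x} → I x → ∃ λ y → x ≺ y × I y
  expand {x} = to (rounded x)

module ProximityPosetProperties (S : ProximityPoset) where
  open ProximityPoset S public

  infix 4 _⊆ᴵ_
  _⊆ᴵ_ : RIdl S → RIdl S → Set
  _⊆ᴵ_ = _⊆I_ S

  ≺-trans : ∀ {x y z} → x ≺ y → y ≺ z → x ≺ z
  ≺-trans {z = z} = RoundedIdeal.≺-closed (lowerRIdeal z)

  ≺-≤-trans : ∀ {x y z} → x ≺ y → y ≤ z → x ≺ z
  ≺-≤-trans {x} x≺y y≤z = IsRoundedUpper.upClosed (upperRUpper x) y≤z x≺y

  ⊇⇒≤U : ∀ {A B} → B ⊆ A → _≤U_ S A B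
  ⊇⇒≤U B⊆A {b} b∈B = b , B⊆A b∈B , IsPartialOrder.refl isPartialOrder

  pair-≤U : ∀ {x x′ y y′} → x ≤ x′ → y ≤ y′ → _≤U_ S (x ∷ y ∷ []) (x′ ∷ y′ ∷ [])
  pair-≤U x≤x′ _    (here refl)         = _ , here refl , x≤x′
  pair-≤U _    y≤y′ (there (here refl)) = _ , there (here refl) , y≤y′

module FromCoalgebra (S : ProximityPoset)
                     (α : REL (ProximityPoset.Carrier S) (Fin (ProximityPoset.Carrier S)) 0ℓ)
                     (isCoalgebra : IsPUCoalgebra S α) where
  open ProximityPosetProperties S
  open IsPUCoalgebra isCoalgebra
  open IsApproximable approximable

  α-upClosed : ∀ {a A B} → _≤U_ S A B → α a A → α a B
  α-upClosed {a} = IsRoundedUpper.upClosed (upper a)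

  α-singleton : ∀ {a b} → α a [ b ] ⇔ a ≺ b
  α-singleton {a} {b} = counitLaw a b ⇔-∘ (∃-×-comm ⇔-∘ IsRoundedUpper.rounded (upper a) [ b ])

  ⊤ : RIdl S
  ⊤ = record { pred = λ a → α a [] ; isRIdl = ideal [] }

  ⊤-maximum : ∀ I → I ⊆ᴵ ⊤
  ⊤-maximum I Ia =
    let (_ , a≺y , _) = RoundedIdeal.expand (isRIdl I) Ia
    in α-upClosed (⊇⇒≤U λ ()) (from α-singleton a≺y)

  _∧_ : RIdl S → RIdl S → RIdl S
  I ∧ J = record { pred = ∧-pred ; isRIdl = ∧-isRIdl }
    where
    ∧-pred : Carrier → Set
    ∧-pred a = ∃₂ λ x y → pred I x × pred J y × α a (x ∷ y ∷ [])

    ideal-xy : ∀ x y → IsRoundedIdeal _≤_ _≺_ (λ a → α a (x ∷ y ∷ []))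
    ideal-xy x y = ideal (x ∷ y ∷ [])

    ∧-isRIdl : IsRoundedIdeal _≤_ _≺_ ∧-pred
    ∧-isRIdl = record
      { downClosed = λ a≤b (x , y , Ix , Jy , p) →
          x , y , Ix , Jy , IsRoundedIdeal.downClosed (ideal-xy x y) a≤b p
      ; inhabited =
          let (x , Ix) = IsRoundedIdeal.inhabited (isRIdl I)
              (y , Jy) = IsRoundedIdeal.inhabited (isRIdl J)
              (a , p)  = IsRoundedIdeal.inhabited (ideal-xy x y)
          in a , x , y , Ix , Jy , p
      ; directed = λ (x₁ , y₁ , Ix₁ , Jy₁ , p₁) (x₂ , y₂ , Ix₂ , Jy₂ , p₂) →
          let (x , Ix , x₁≤x , x₂≤x) = IsRoundedIdeal.directed (isRIdl I) Ix₁ Ix₂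
              (y , Jy , y₁≤y , y₂≤y) = IsRoundedIdeal.directed (isRIdl J) Jy₁ Jy₂
              (c , p , a₁≤c , a₂≤c) = IsRoundedIdeal.directed (ideal-xy x y)
                (α-upClosed (pair-≤U x₁≤x y₁≤y) p₁) (α-upClosed (pair-≤U x₂≤x y₂≤y) p₂)
          in c , (x , y , Ix , Jy , p) , a₁≤c , a₂≤c
      ; rounded = λ a → mk⇔
          (λ (x , y , Ix , Jy , p) →
            let (b , a≺b , pb) = RoundedIdeal.expand (ideal-xy x y) p
            in b , a≺b , x , y , Ix , Jy , pb)
          (λ (b , a≺b , x , y , Ix , Jy , pb) →
            x , y , Ix , Jy , RoundedIdeal.≺-closed (ideal-xy x y) a≺b pb)
      }

  ∧-lowerBound₁ : ∀ I J → I ∧ J ⊆ᴵ I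
  ∧-lowerBound₁ I J (x , y , Ix , Jy , p) =
    RoundedIdeal.≺-closed (isRIdl I) (to α-singleton (α-upClosed (⊇⇒≤U λ { (here refl) → here refl }) p)) Ix

  ∧-lowerBound₂ : ∀ I J → I ∧ J ⊆ᴵ J
  ∧-lowerBound₂ I J (x , y , Ix , Jy , p) =
    RoundedIdeal.≺-closed (isRIdl J) (to α-singleton (α-upClosed (⊇⇒≤U λ { (here refl) → there (here refl) }) p)) Jy

  ∧-greatest : ∀ I J K → K ⊆ᴵ I → K ⊆ᴵ J → K ⊆ᴵ I ∧ J
  ∧-greatest I J K K⊆I K⊆J Ka =
    let (a′ , a≺a′ , Ka′) = RoundedIdeal.expand (isRIdl K) Ka
        a′a′⊆a′ : (a′ ∷ a′ ∷ []) ⊆ [ a′ ]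
        a′a′⊆a′ = λ { (here refl) → here refl ; (there (here refl)) → here refl }
    in a′ , a′ , K⊆I Ka′ , K⊆J Ka′ , α-upClosed (⊇⇒≤U a′a′⊆a′) (from α-singleton a≺a′)

  hasFiniteMeets : HasFiniteMeets S
  hasFiniteMeets = record
    { top = ⊤ ; top-max = ⊤-maximum
    ; meet = _∧_ ; meet-lb₁ = ∧-lowerBound₁ ; meet-lb₂ = ∧-lowerBound₂ ; meet-glb = ∧-greatest
    }

module FromFiniteMeets (S : ProximityPoset) (finiteMeets : HasFiniteMeets S) where
  open ProximityPosetProperties S
  open HasFiniteMeets finiteMeets

  ↓_ : Carrier → RIdl S
  ↓ b = record { pred = λ x → x ≺ b ; isRIdl = lowerRIdeal b }

  ↓-mono-≺ : ∀ {b c} → b ≺ c → ↓ b ⊆ᴵ ↓ c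
  ↓-mono-≺ b≺c x≺b = ≺-trans x≺b b≺c

  ↓-mono-≤ : ∀ {b c} → b ≤ c → ↓ b ⊆ᴵ ↓ c
  ↓-mono-≤ b≤c x≺b = ≺-≤-trans x≺b b≤c

  ⋀↓ : Fin Carrier → RIdl S
  ⋀↓ []      = top
  ⋀↓ (b ∷ B) = meet (↓ b) (⋀↓ B)

  ⋀↓-lowerBound : ∀ {b B} → b ∈ B → ⋀↓ B ⊆ᴵ ↓ b
  ⋀↓-lowerBound {b} {_ ∷ B} (here refl) = meet-lb₁ (↓ b) (⋀↓ B)
  ⋀↓-lowerBound {b} {c ∷ B} (there b∈B) = ⋀↓-lowerBound b∈B ∘ meet-lb₂ (↓ c) (⋀↓ B)

  ⋀↓-greatest : ∀ K B → (∀ {b} → b ∈ B → K ⊆ᴵ ↓ b) → K ⊆ᴵ ⋀↓ B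
  ⋀↓-greatest K []      _   = top-max K
  ⋀↓-greatest K (b ∷ B) K⊆B =
    meet-glb (↓ b) (⋀↓ B) K (K⊆B (here refl)) (⋀↓-greatest K B (K⊆B ∘ there))

  ⋀↓-mono : ∀ {R : Rel Carrier 0ℓ} → (∀ {b c} → R b c → ↓ b ⊆ᴵ ↓ c) →
            ∀ {A B} → A [ R ]U B → ⋀↓ A ⊆ᴵ ⋀↓ B
  ⋀↓-mono ↓-mono {A} {B} A≤B = ⋀↓-greatest (⋀↓ A) B λ c∈B →
    let (b , b∈A , bRc) = A≤B c∈B in ↓-mono bRc ∘ ⋀↓-lowerBound b∈A

  α : REL Carrier (Fin Carrier) 0ℓ
  α a A = pred (⋀↓ A) a

  α-singleton : ∀ {a b} → α a [ b ] ⇔ a ≺ b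
  α-singleton {b = b} = mk⇔ (⋀↓-lowerBound {B = [ b ]} (here refl))
    (meet-glb (↓ b) top (↓ b) (λ x≺b → x≺b) (top-max (↓ b)))

  α-expand : ∀ {a B} → α a B → ∃ λ a′ → a ≺ a′ × α a′ B
  α-expand {B = B} = RoundedIdeal.expand (isRIdl (⋀↓ B))

  α-rounded : ∀ {a B} → α a B ⇔ (∃ λ A → α a A × _≺U_ S A B)
  α-rounded {B = B} = mk⇔
    (λ p → let (a′ , a≺a′ , p′) = α-expand {B = B} p
           in [ a′ ] , from α-singleton a≺a′ , λ {_} b∈B → a′ , here refl , ⋀↓-lowerBound b∈B p′)
    (λ (A , p , A≺B) → ⋀↓-mono ↓-mono-≺ A≺B p)

  ⋀↓-concat-lowerBound : ∀ {U 𝒰} → U ∈ 𝒰 → ⋀↓ (concat 𝒰) ⊆ᴵ ⋀↓ U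
  ⋀↓-concat-lowerBound {U} {𝒰} U∈𝒰 = ⋀↓-greatest (⋀↓ (concat 𝒰)) U λ b∈U → ⋀↓-lowerBound (∈-concat⁺′ b∈U U∈𝒰)

  ⋀↓-concat-greatest : ∀ {A 𝒰} → A [ α ]U 𝒰 → ⋀↓ A ⊆ᴵ ⋀↓ (concat 𝒰)
  ⋀↓-concat-greatest {A} {𝒰} A≤𝒰 = ⋀↓-greatest (⋀↓ A) (concat 𝒰) λ b∈⋃𝒰 x∈⋀A →
    let (U , b∈U , U∈𝒰) = ∈-concat⁻′ 𝒰 b∈⋃𝒰
        (c , c∈A , c∈⋀U) = A≤𝒰 U∈𝒰
    in ≺-trans (⋀↓-lowerBound c∈A x∈⋀A) (⋀↓-lowerBound b∈U c∈⋀U)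

  α-concat : ∀ {a 𝒰} → α a (concat 𝒰) ⇔ (∃ λ A → α a A × A [ α ]U 𝒰)
  α-concat {𝒰 = 𝒰} = mk⇔
    (λ p → let (a′ , a≺a′ , p′) = α-expand {B = concat 𝒰} p
           in [ a′ ] , from α-singleton a≺a′ , λ {_} U∈𝒰 → a′ , here refl , ⋀↓-concat-lowerBound U∈𝒰 p′)
    (λ (A , p , A≤𝒰) → ⋀↓-concat-greatest A≤𝒰 p)

  isPUCoalgebra : IsPUCoalgebra S α
  isPUCoalgebra = record
    { approximable = record
      { ideal = λ B → isRIdl (⋀↓ B)
      ; upper = λ a → record
        { upClosed = λ A≤B → ⋀↓-mono ↓-mono-≤ A≤B
        ; rounded  = λ _ → ∃-×-comm ⇔-∘ α-rounded
        }
      }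
    ; counitLaw  = λ _ _ → α-singleton ⇔-∘ ⇔-sym α-rounded
    ; coassocLaw = λ _ _ → α-concat ⇔-∘ ⇔-sym α-rounded
    }

proposition3p37 : (S : ProximityPoset) → HasPUCoalgebra S ⇔ HasFiniteMeets S
proposition3p37 S = mk⇔
  (λ (α , isCoalgebra) → FromCoalgebra.hasFiniteMeets S α isCoalgebra)
  (λ finiteMeets → FromFiniteMeets.α S finiteMeets , FromFiniteMeets.isPUCoalgebra S finiteMeets)
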